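{- Suppose $d$ is a positive even integer. Then there exists a set of $d-1$ mutually quasi-unbiased weighing matrices for parameters $(d,2,4,1)$.
   Context: A weighing matrix of order $d$ and weight $k$ is a $d\times d$ matrix $W$ with entries in $\{0,\pm1\}$ with $WW^T=kI$. Two weighing matrices $W_1,W_2$ of order $d$ and weight $k$ are quasi-unbiased for parameters $(d,k,l,a)$ if $\frac{1}{\sqrt a}W_1W_2^T$ is a weighing matrix of weight $l$. A set is mutually quasi-unbiased for $(d,k,l,a)$ if any two distinct members are quasi-unbiased for $(d,k,l,a)$. -}

module Defs where

import Data.Nat
import Data.Fin
import Data.Integer
open import Data.Nat using (ℕ)
open import Data.Fin using (Fin; _≟_)
open import Data.Product using (_×_; Σ)
open import Relation.Nullary using (¬_)
open import Data.Integer using (ℤ; +_; _*_; 0ℤ; 1ℤ; -1ℤ)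
open import Data.Bool using (if_then_else_)
open import Relation.Nullary.Decidable using (does)
open import Relation.Binary.PropositionalEquality using (_≡_)
open import Data.Sum using (_⊎_)

Mat : ℕ → Set
Mat d = Fin d → Fin d → ℤ

sumℤ : (n : ℕ) → (Fin n → ℤ) → ℤ
sumℤ Data.Nat.zero f = 0ℤ
sumℤ (Data.Nat.suc n) f = f Data.Fin.zero Data.Integer.+ sumℤ n (λ i → f (Data.Fin.suc i))

_·ᵀ_ : ∀ {d} → Mat d → Mat d → Mat d
(A ·ᵀ B) i j = sumℤ _ (λ t → A i t * B j t)

scalarI : ∀ {d} → ℤ → Mat d
scalarI c i j = if does (i ≟ j) then c else 0ℤ

Ternary : ∀ {d} → Mat d → Set
Ternary W = ∀ i j → (W i j ≡ 0ℤ) ⊎ ((W i j ≡ 1ℤ) ⊎ (W i j ≡ -1ℤ))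

IsWeighing : (d k : ℕ) → Mat d → Set
IsWeighing d k W = Ternary W × (∀ i j → (W ·ᵀ W) i j ≡ scalarI (+ k) i j)

-- quasi-unbiased for parameters (d,k,l,a) with a = s², s ≥ 0:
-- (1/√a) W₁ W₂ᵀ = (1/s) W₁ W₂ᵀ is a weighing matrix of weight l,
-- i.e. W₁ W₂ᵀ = s · W' for some weighing matrix W' of weight l.
QuasiUnbiased : (d k l s : ℕ) → Mat d → Mat d → Set
QuasiUnbiased d k l s W₁ W₂ =
  IsWeighing d k W₁ × IsWeighing d k W₂ ×
  Σ (Mat d) (λ W' → IsWeighing d l W' × (∀ i j → (W₁ ·ᵀ W₂) i j ≡ (+ s) * W' i j))

MutuallyQU : (d k l s m : ℕ) → (Fin m → Mat d) → Set
MutuallyQU d k l s m W =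
  (∀ x → IsWeighing d k (W x)) ×
  (∀ x y → ¬ (x ≡ y) → ¬ (∀ i j → W x i j ≡ W y i j)) ×
  (∀ x y → ¬ (x ≡ y) → QuasiUnbiased d k l s (W x) (W y))

module Submission where

-- For a perfect matching p of {0, …, d − 1} let W = P + D, where P is the permutation
-- matrix of p and D is diagonal with Dᵢᵢ = 1 if i < p i and −1 otherwise.  W is
-- symmetric, P² = D² = I, and P D + D P = 0 because D takes opposite values at the two
-- ends of every edge; hence W Wᵀ = W² = 2I.  For disjoint matchings p, q with matrices
-- W, V the entry (W Vᵀ)ᵢₖ = W(i, q k) + D_q(k) W(i, k) has at most one nonzero term,
-- so W Vᵀ has entries in {0, ±1}, and (W Vᵀ)(W Vᵀ)ᵀ = W V² Wᵀ = 4I.  For even d the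
-- round-robin tournament on d players provides d − 1 pairwise disjoint perfect matchings.

open import Defs
open import Data.Nat using (ℕ)
open import Data.Fin using (Fin)
open import Relation.Binary.PropositionalEquality using (_≡_; _≢_; refl; sym; trans; cong)

record PerfectMatching (d : ℕ) : Set where
  field
    partner                  : Fin d → Fin d
    partner-involutive       : ∀ i → partner (partner i) ≡ i
    partner-fixed-point-free : ∀ i → partner i ≢ i

  partner-injective : ∀ {i j} → partner i ≡ partner j → i ≡ j
  partner-injective {i} {j} eq =
    trans (sym (partner-involutive i)) (trans (cong partner eq) (partner-involutive j))

  partner-swap : ∀ {i j} → partner i ≡ j → partner j ≡ i
  partner-swap {i} refl = partner-involutive i

Disjoint : ∀ {d} → PerfectMatching d → PerfectMatching d → Set
Disjoint M N = ∀ i → PerfectMatching.partner M i ≢ PerfectMatching.partner N i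

record DisjointPerfectMatchings (d n : ℕ) : Set where
  field
    matching : Fin n → PerfectMatching d
    disjoint : ∀ {x y} → x ≢ y → Disjoint (matching x) (matching y)

module WeighingMatrices where

  open import Data.Nat using (zero; suc)
  import Data.Nat.Properties as ℕₚ
  open import Data.Fin using (_≟_) renaming (zero to fzero; suc to fsuc)
  open import Data.Fin.Properties using (_<?_; <-asym; ≤-antisym)
  import Data.Integer as ℤ
  open import Data.Integer using (ℤ; +_; _+_; _*_; -_; 0ℤ; 1ℤ; -1ℤ)
  open import Data.Integer.Properties
    using (+-*-semiring; +-identityˡ; +-identityʳ; +-inverseʳ; *-identityˡ; *-identityʳ; *-zeroʳ)
  open import Algebra.Properties.Semiring.Sum +-*-semiring
    using (sum; sum-syntax; sum-cong-≗; ∑-comm; ∑-distrib-+; *-distribˡ-sum; *-distribʳ-sum)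
  open import Data.Integer.Tactic.RingSolver using (solve-∀)
  open import Data.Product using (_,_)
  open import Data.Sum using (_⊎_; inj₁; inj₂)
  open import Data.Empty using (⊥-elim)
  open import Function using (_∘_)
  open import Relation.Nullary using (¬_; yes; no; contradiction)
  open import Relation.Nullary.Decidable using (toSum)
  open import Relation.Binary.PropositionalEquality using (subst; cong₂; module ≡-Reasoning)

  sumℤ≗sum : ∀ n (f : Fin n → ℤ) → sumℤ n f ≡ sum f
  sumℤ≗sum zero f = refl
  sumℤ≗sum (suc n) f = cong (_+_ (f fzero)) (sumℤ≗sum n (λ i → f (fsuc i)))

  sum-*-scalarI : ∀ {n} (f : Fin n → ℤ) c a → ∑[ t < n ] (f t * scalarI c a t) ≡ f a * c
  sum-*-scalarI {suc n} f c fzero = trans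
    (cong (_+_ (f fzero * c)) (trans (sym (*-distribʳ-sum 0ℤ (f ∘ fsuc))) (*-zeroʳ (sum (f ∘ fsuc)))))
    (+-identityʳ (f fzero * c))
  sum-*-scalarI {suc n} f c (fsuc a) = trans
    (cong₂ _+_ (*-zeroʳ (f fzero)) (sum-*-scalarI (f ∘ fsuc) c a))
    (+-identityˡ (f (fsuc a) * c))

  ·ᵀ-as-sum : ∀ {d} (A B : Mat d) i j → (A ·ᵀ B) i j ≡ ∑[ t < d ] (A i t * B j t)
  ·ᵀ-as-sum {d} A B i j = sumℤ≗sum d (λ t → A i t * B j t)

  ·ᵀ-gram-orthogonal : ∀ {d} (c : ℤ) (A B : Mat d) →
    (∀ t u → B t u ≡ B u t) → (∀ t u → (B ·ᵀ B) t u ≡ scalarI c t u) →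
    ∀ i j → ((A ·ᵀ B) ·ᵀ (A ·ᵀ B)) i j ≡ (A ·ᵀ A) i j * c
  ·ᵀ-gram-orthogonal {d} c A B B-symmetric B-orthogonal i j = begin
    ((A ·ᵀ B) ·ᵀ (A ·ᵀ B)) i j
      ≡⟨ ·ᵀ-as-sum (A ·ᵀ B) (A ·ᵀ B) i j ⟩
    ∑[ k < d ] ((A ·ᵀ B) i k * (A ·ᵀ B) j k)
      ≡⟨ sum-cong-≗ expand ⟩
    ∑[ k < d ] ∑[ t < d ] ∑[ u < d ] ((A i t * B k t) * (A j u * B k u))
      ≡⟨ trans (∑-comm (λ k t → ∑[ u < d ] ((A i t * B k t) * (A j u * B k u))))
               (sum-cong-≗ λ t → ∑-comm (λ k u → (A i t * B k t) * (A j u * B k u))) ⟩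
    ∑[ t < d ] ∑[ u < d ] ∑[ k < d ] ((A i t * B k t) * (A j u * B k u))
      ≡⟨ sum-cong-≗ (λ t → sum-cong-≗ (collect t)) ⟩
    ∑[ t < d ] ∑[ u < d ] ((A i t * A j u) * scalarI c t u)
      ≡⟨ sum-cong-≗ (λ t → sum-*-scalarI (λ u → A i t * A j u) c t) ⟩
    ∑[ t < d ] ((A i t * A j t) * c)
      ≡⟨ *-distribʳ-sum c (λ t → A i t * A j t) ⟨
    (∑[ t < d ] (A i t * A j t)) * c
      ≡⟨ cong (_* c) (·ᵀ-as-sum A A i j) ⟨
    (A ·ᵀ A) i j * c ∎
    where
    open ≡-Reasoning

    expand : ∀ k → (A ·ᵀ B) i k * (A ·ᵀ B) j k
                 ≡ ∑[ t < d ] ∑[ u < d ] ((A i t * B k t) * (A j u * B k u))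
    expand k = begin
      (A ·ᵀ B) i k * (A ·ᵀ B) j k
        ≡⟨ cong₂ _*_ (·ᵀ-as-sum A B i k) (·ᵀ-as-sum A B j k) ⟩
      (∑[ t < d ] (A i t * B k t)) * (∑[ u < d ] (A j u * B k u))
        ≡⟨ *-distribʳ-sum (∑[ u < d ] (A j u * B k u)) (λ t → A i t * B k t) ⟩
      ∑[ t < d ] ((A i t * B k t) * ∑[ u < d ] (A j u * B k u))
        ≡⟨ sum-cong-≗ (λ t → *-distribˡ-sum (A i t * B k t) (λ u → A j u * B k u)) ⟩
      ∑[ t < d ] ∑[ u < d ] ((A i t * B k t) * (A j u * B k u)) ∎

    regroup : ∀ a b e f → (a * b) * (e * f) ≡ (a * e) * (b * f)
    regroup = solve-∀

    collect : ∀ t u → ∑[ k < d ] ((A i t * B k t) * (A j u * B k u)) ≡ (A i t * A j u) * scalarI c t u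
    collect t u = begin
      ∑[ k < d ] ((A i t * B k t) * (A j u * B k u))
        ≡⟨ sum-cong-≗ (λ k → cong₂ (λ x y → (A i t * x) * (A j u * y))
                                   (B-symmetric k t) (B-symmetric k u)) ⟩
      ∑[ k < d ] ((A i t * B t k) * (A j u * B u k))
        ≡⟨ sum-cong-≗ (λ k → regroup (A i t) (B t k) (A j u) (B u k)) ⟩
      ∑[ k < d ] ((A i t * A j u) * (B t k * B u k))
        ≡⟨ *-distribˡ-sum (A i t * A j u) (λ k → B t k * B u k) ⟨
      (A i t * A j u) * ∑[ k < d ] (B t k * B u k)
        ≡⟨ cong (A i t * A j u *_) (trans (sym (·ᵀ-as-sum B B t u)) (B-orthogonal t u)) ⟩
      (A i t * A j u) * scalarI c t u ∎

  Trit : ℤ → Set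
  Trit z = (z ≡ 0ℤ) ⊎ ((z ≡ 1ℤ) ⊎ (z ≡ -1ℤ))

  0-trit : Trit 0ℤ
  0-trit = inj₁ refl

  1-trit : Trit 1ℤ
  1-trit = inj₂ (inj₁ refl)

  data IsSign : ℤ → Set where
    positive : IsSign 1ℤ
    negative : IsSign -1ℤ

  IsSign⇒Trit : ∀ {s} → IsSign s → Trit s
  IsSign⇒Trit positive = inj₂ (inj₁ refl)
  IsSign⇒Trit negative = inj₂ (inj₂ refl)

  IsSign⇒square≡1 : ∀ {s} → IsSign s → s * s ≡ 1ℤ
  IsSign⇒square≡1 positive = refl
  IsSign⇒square≡1 negative = refl

  Trit-* : ∀ {s x} → IsSign s → Trit x → Trit (s * x)
  Trit-* positive (inj₁ refl)        = inj₁ refl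
  Trit-* positive (inj₂ (inj₁ refl)) = inj₂ (inj₁ refl)
  Trit-* positive (inj₂ (inj₂ refl)) = inj₂ (inj₂ refl)
  Trit-* negative (inj₁ refl)        = inj₁ refl
  Trit-* negative (inj₂ (inj₁ refl)) = inj₂ (inj₂ refl)
  Trit-* negative (inj₂ (inj₂ refl)) = inj₂ (inj₁ refl)

  scalarI-≡ : ∀ {d} c {i j : Fin d} → i ≡ j → scalarI c i j ≡ c
  scalarI-≡ c {i} {j} i≡j with i ≟ j
  ... | yes _   = refl
  ... | no i≢j  = ⊥-elim (i≢j i≡j)

  scalarI-≢ : ∀ {d} c {i j : Fin d} → i ≢ j → scalarI c i j ≡ 0ℤ
  scalarI-≢ c {i} {j} i≢j with i ≟ j
  ... | yes i≡j = ⊥-elim (i≢j i≡j)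
  ... | no _    = refl

  scalarI-*ʳ : ∀ {d} a b (i j : Fin d) → scalarI a i j * b ≡ scalarI (a * b) i j
  scalarI-*ʳ a b i j with i ≟ j
  ... | yes _ = refl
  ... | no _  = refl

  δ : ∀ {d} → Fin d → Fin d → ℤ
  δ = scalarI 1ℤ

  *-δ-symmetric : ∀ {d} (f : Fin d → ℤ) i j → f i * δ i j ≡ f j * δ j i
  *-δ-symmetric f i j with i ≟ j | j ≟ i
  ... | yes refl | yes _   = refl
  ... | yes refl | no i≢i  = ⊥-elim (i≢i refl)
  ... | no i≢j   | yes j≡i = ⊥-elim (i≢j (sym j≡i))
  ... | no _     | no _    = trans (*-zeroʳ (f i)) (sym (*-zeroʳ (f j)))

  δ-≡ : ∀ {d} {i j : Fin d} → i ≡ j → δ i j ≡ 1ℤ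
  δ-≡ = scalarI-≡ 1ℤ

  δ-refl : ∀ {d} (i : Fin d) → δ i i ≡ 1ℤ
  δ-refl i = δ-≡ {i = i} refl

  δ-≢ : ∀ {d} {i j : Fin d} → i ≢ j → δ i j ≡ 0ℤ
  δ-≢ = scalarI-≢ 1ℤ

  orientation : ∀ {d} → Fin d → Fin d → ℤ
  orientation i j with i <? j
  ... | yes _ = 1ℤ
  ... | no _  = -1ℤ

  orientation-isSign : ∀ {d} (i j : Fin d) → IsSign (orientation i j)
  orientation-isSign i j with i <? j
  ... | yes _ = positive
  ... | no _  = negative

  orientation-flip : ∀ {d} {i j : Fin d} → i ≢ j → orientation j i ≡ - orientation i j
  orientation-flip {i = i} {j} i≢j with i <? j | j <? i
  ... | yes i<j | yes j<i = ⊥-elim (<-asym i<j j<i)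
  ... | yes _   | no _    = refl
  ... | no _    | yes _   = refl
  ... | no i≮j  | no j≮i  = ⊥-elim (i≢j (≤-antisym (ℕₚ.≮⇒≥ j≮i) (ℕₚ.≮⇒≥ i≮j)))

  module MatchingMatrix {d} (M : PerfectMatching d) where

    open PerfectMatching M public

    sign : Fin d → ℤ
    sign i = orientation i (partner i)

    sign-isSign : ∀ i → IsSign (sign i)
    sign-isSign i = orientation-isSign i (partner i)

    sign-partner : ∀ i → sign (partner i) ≡ - sign i
    sign-partner i = trans (cong (orientation (partner i)) (partner-involutive i))
                           (orientation-flip (partner-fixed-point-free i ∘ sym))

    matrix : Mat d
    matrix i j = δ (partner i) j + sign i * δ i j

    ·ᵀ-matrix : ∀ (A : Mat d) i k → (A ·ᵀ matrix) i k ≡ A i (partner k) + sign k * A i k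
    ·ᵀ-matrix A i k = begin
      (A ·ᵀ matrix) i k
        ≡⟨ ·ᵀ-as-sum A matrix i k ⟩
      ∑[ t < d ] (A i t * (δ (partner k) t + sign k * δ k t))
        ≡⟨ sum-cong-≗ (λ t → distribute (A i t) (δ (partner k) t) (sign k) (δ k t)) ⟩
      ∑[ t < d ] (A i t * δ (partner k) t + sign k * (A i t * δ k t))
        ≡⟨ ∑-distrib-+ (λ t → A i t * δ (partner k) t) (λ t → sign k * (A i t * δ k t)) ⟩
      ∑[ t < d ] (A i t * δ (partner k) t) + ∑[ t < d ] (sign k * (A i t * δ k t))
        ≡⟨ cong₂ _+_ (sum-*-scalarI (A i) 1ℤ (partner k))
                     (trans (sym (*-distribˡ-sum (sign k) (λ t → A i t * δ k t)))
                            (cong (sign k *_) (sum-*-scalarI (A i) 1ℤ k))) ⟩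
      A i (partner k) * 1ℤ + sign k * (A i k * 1ℤ)
        ≡⟨ cong₂ (λ x y → x + sign k * y) (*-identityʳ (A i (partner k))) (*-identityʳ (A i k)) ⟩
      A i (partner k) + sign k * A i k ∎
      where
      open ≡-Reasoning
      distribute : ∀ a b s e → a * (b + s * e) ≡ a * b + s * (a * e)
      distribute = solve-∀

    δ-partner-symmetric : ∀ i j → δ (partner i) j ≡ δ (partner j) i
    δ-partner-symmetric i j with partner i ≟ j
    ... | yes pi≡j = sym (δ-≡ (partner-swap pi≡j))
    ... | no pi≢j  = sym (δ-≢ (pi≢j ∘ partner-swap))

    matrix-symmetric : ∀ i j → matrix i j ≡ matrix j i
    matrix-symmetric i j = cong₂ _+_ (δ-partner-symmetric i j) (*-δ-symmetric sign i j)

    matrix-at-partner : ∀ i → matrix i (partner i) ≡ 1ℤ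
    matrix-at-partner i = begin
      δ (partner i) (partner i) + sign i * δ i (partner i)
        ≡⟨ cong₂ (λ x y → x + sign i * y)
                 (δ-refl (partner i)) (δ-≢ (partner-fixed-point-free i ∘ sym)) ⟩
      1ℤ + sign i * 0ℤ
        ≡⟨ cong (_+_ 1ℤ) (*-zeroʳ (sign i)) ⟩
      1ℤ ∎
      where open ≡-Reasoning

    matrix-at-diagonal : ∀ i → matrix i i ≡ sign i
    matrix-at-diagonal i = begin
      δ (partner i) i + sign i * δ i i
        ≡⟨ cong₂ (λ x y → x + sign i * y) (δ-≢ (partner-fixed-point-free i)) (δ-refl i) ⟩
      0ℤ + sign i * 1ℤ
        ≡⟨ trans (+-identityˡ (sign i * 1ℤ)) (*-identityʳ (sign i)) ⟩
      sign i ∎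
      where open ≡-Reasoning

    matrix-off-support : ∀ {i j} → j ≢ partner i → j ≢ i → matrix i j ≡ 0ℤ
    matrix-off-support {i} {j} j≢pi j≢i = begin
      δ (partner i) j + sign i * δ i j
        ≡⟨ cong₂ (λ x y → x + sign i * y) (δ-≢ (j≢pi ∘ sym)) (δ-≢ (j≢i ∘ sym)) ⟩
      0ℤ + sign i * 0ℤ
        ≡⟨ trans (+-identityˡ (sign i * 0ℤ)) (*-zeroʳ (sign i)) ⟩
      0ℤ ∎
      where open ≡-Reasoning

    matrix-support : ∀ {i j} → matrix i j ≢ 0ℤ → j ≡ partner i ⊎ j ≡ i
    matrix-support {i} {j} nonzero with toSum (j ≟ partner i) | toSum (j ≟ i)
    ... | inj₁ j≡pi | _         = inj₁ j≡pi
    ... | inj₂ _    | inj₁ j≡i  = inj₂ j≡i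
    ... | inj₂ j≢pi | inj₂ j≢i  = ⊥-elim (nonzero (matrix-off-support j≢pi j≢i))

    matrix-ternary : Ternary matrix
    matrix-ternary i j with toSum (j ≟ partner i) | toSum (j ≟ i)
    ... | inj₁ refl | _         = subst Trit (sym (matrix-at-partner i)) 1-trit
    ... | inj₂ _    | inj₁ refl = subst Trit (sym (matrix-at-diagonal i)) (IsSign⇒Trit (sign-isSign i))
    ... | inj₂ j≢pi | inj₂ j≢i  = subst Trit (sym (matrix-off-support j≢pi j≢i)) 0-trit

    matrix-·ᵀ-self : ∀ i k → (matrix ·ᵀ matrix) i k ≡ scalarI (+ 2) i k
    matrix-·ᵀ-self i k with toSum (i ≟ k) | toSum (partner i ≟ k)
    ... | inj₁ refl | _ = begin
      (matrix ·ᵀ matrix) i i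
        ≡⟨ ·ᵀ-matrix matrix i i ⟩
      matrix i (partner i) + sign i * matrix i i
        ≡⟨ cong₂ (λ x y → x + sign i * y) (matrix-at-partner i) (matrix-at-diagonal i) ⟩
      1ℤ + sign i * sign i
        ≡⟨ cong (_+_ 1ℤ) (IsSign⇒square≡1 (sign-isSign i)) ⟩
      + 2
        ≡⟨ scalarI-≡ (+ 2) {i} refl ⟨
      scalarI (+ 2) i i ∎
      where open ≡-Reasoning
    ... | inj₂ i≢k | inj₁ refl = begin
      (matrix ·ᵀ matrix) i (partner i)
        ≡⟨ ·ᵀ-matrix matrix i (partner i) ⟩
      matrix i (partner (partner i)) + sign (partner i) * matrix i (partner i)
        ≡⟨ cong₂ _+_ (trans (cong (matrix i) (partner-involutive i)) (matrix-at-diagonal i))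
                     (cong₂ _*_ (sign-partner i) (matrix-at-partner i)) ⟩
      sign i + - sign i * 1ℤ
        ≡⟨ trans (cong (_+_ (sign i)) (*-identityʳ (- sign i))) (+-inverseʳ (sign i)) ⟩
      0ℤ
        ≡⟨ scalarI-≢ (+ 2) i≢k ⟨
      scalarI (+ 2) i (partner i) ∎
      where open ≡-Reasoning
    ... | inj₂ i≢k | inj₂ pi≢k = begin
      (matrix ·ᵀ matrix) i k
        ≡⟨ ·ᵀ-matrix matrix i k ⟩
      matrix i (partner k) + sign k * matrix i k
        ≡⟨ cong₂ (λ x y → x + sign k * y) (matrix-off-support pk≢pi pk≢i)
                                          (matrix-off-support (pi≢k ∘ sym) (i≢k ∘ sym)) ⟩
      0ℤ + sign k * 0ℤ
        ≡⟨ trans (+-identityˡ (sign k * 0ℤ)) (*-zeroʳ (sign k)) ⟩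
      0ℤ
        ≡⟨ scalarI-≢ (+ 2) i≢k ⟨
      scalarI (+ 2) i k ∎
      where
      open ≡-Reasoning
      pk≢pi : partner k ≢ partner i
      pk≢pi = i≢k ∘ sym ∘ partner-injective
      pk≢i : partner k ≢ i
      pk≢i = pi≢k ∘ partner-swap

    matrix-weighing : IsWeighing d 2 matrix
    matrix-weighing = matrix-ternary , matrix-·ᵀ-self

  module _ {d} (M N : PerfectMatching d) (M-N-disjoint : Disjoint M N) where
    private
      module M = MatchingMatrix M
      module N = MatchingMatrix N

    product-terms-exclusive : ∀ {i k} → M.matrix i (N.partner k) ≢ 0ℤ → M.matrix i k ≡ 0ℤ
    product-terms-exclusive {i} {k} first≢0 with M.matrix-support first≢0
    ... | inj₁ qk≡pi = M.matrix-off-support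
      (λ k≡pi → N.partner-fixed-point-free k (trans qk≡pi (sym k≡pi)))
      (λ k≡i → M-N-disjoint i (sym (subst (λ x → N.partner x ≡ M.partner i) k≡i qk≡pi)))
    ... | inj₂ qk≡i = M.matrix-off-support
      (λ k≡pi → M-N-disjoint i (trans (sym k≡pi) (sym (N.partner-swap qk≡i))))
      (λ k≡i → N.partner-fixed-point-free k (trans qk≡i (sym k≡i)))

    product-ternary : Ternary (M.matrix ·ᵀ N.matrix)
    product-ternary i k = subst Trit (sym (N.·ᵀ-matrix M.matrix i k)) entry-ternary
      where
      entry-ternary : Trit (M.matrix i (N.partner k) + N.sign k * M.matrix i k)
      entry-ternary with M.matrix i (N.partner k) ℤ.≟ 0ℤ
      ... | yes first≡0 rewrite first≡0 =
        subst Trit (sym (+-identityˡ (N.sign k * M.matrix i k)))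
                   (Trit-* (N.sign-isSign k) (M.matrix-ternary i k))
      ... | no first≢0 rewrite product-terms-exclusive first≢0 | *-zeroʳ (N.sign k) =
        subst Trit (sym (+-identityʳ (M.matrix i (N.partner k)))) (M.matrix-ternary i (N.partner k))

    product-weighing : IsWeighing d 4 (M.matrix ·ᵀ N.matrix)
    product-weighing = product-ternary , λ i j → begin
      ((M.matrix ·ᵀ N.matrix) ·ᵀ (M.matrix ·ᵀ N.matrix)) i j
        ≡⟨ ·ᵀ-gram-orthogonal (+ 2) M.matrix N.matrix N.matrix-symmetric N.matrix-·ᵀ-self i j ⟩
      (M.matrix ·ᵀ M.matrix) i j * + 2
        ≡⟨ cong (_* + 2) (M.matrix-·ᵀ-self i j) ⟩
      scalarI (+ 2) i j * + 2
        ≡⟨ scalarI-*ʳ (+ 2) (+ 2) i j ⟩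
      scalarI (+ 4) i j ∎
      where open ≡-Reasoning

    quasi-unbiased : QuasiUnbiased d 2 4 1 M.matrix N.matrix
    quasi-unbiased = M.matrix-weighing , N.matrix-weighing , (M.matrix ·ᵀ N.matrix) , product-weighing ,
                     λ i j → sym (*-identityˡ ((M.matrix ·ᵀ N.matrix) i j))

    matrices-differ : Fin d → ¬ (∀ i j → M.matrix i j ≡ N.matrix i j)
    matrices-differ i same = contradiction (begin
      1ℤ                       ≡⟨ M.matrix-at-partner i ⟨
      M.matrix i (M.partner i) ≡⟨ same i (M.partner i) ⟩
      N.matrix i (M.partner i) ≡⟨ N.matrix-off-support (M-N-disjoint i) (M.partner-fixed-point-free i) ⟩
      0ℤ                       ∎) λ ()
      where open ≡-Reasoning

  mutually-quasi-unbiased : ∀ {d n} → Fin d → (F : DisjointPerfectMatchings d n) →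
    MutuallyQU d 2 4 1 n (λ x → MatchingMatrix.matrix (DisjointPerfectMatchings.matching F x))
  mutually-quasi-unbiased i F =
    (λ x → MatchingMatrix.matrix-weighing (matching x)) ,
    (λ x y x≢y → matrices-differ (matching x) (matching y) (disjoint x≢y) i) ,
    (λ x y x≢y → quasi-unbiased (matching x) (matching y) (disjoint x≢y))
    where open DisjointPerfectMatchings F

module RoundRobin where

  open import Data.Nat using (suc; _+_; _*_; _∸_; _≤_; _<_; _≤?_; _<?_)
  open import Data.Nat.Properties
    using ( +-assoc; +-comm; +-suc; +-cancelˡ-≡; +-cancelʳ-≡; *-cancelˡ-≡; even≢odd
          ; ≤-trans; ≤-<-trans; <⇒≤; <⇒≱; ≰⇒>; ≮⇒≥; m≤n+m; +-monoˡ-<; +-mono-<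
          ; m∸n≤m; ∸-monoˡ-<; m+n∸m≡n; m+[n∸m]≡n; m∸n+n≡m )
  open import Data.Nat.Tactic.RingSolver using (solve-∀)
  open import Data.Fin using (zero; suc; toℕ; fromℕ<; _≟_)
  open import Data.Fin.Properties using (toℕ-fromℕ<; toℕ-injective; toℕ<n; suc-injective)
  open import Data.Sum using (_⊎_; inj₁; inj₂)
  open import Data.Empty using (⊥-elim)
  open import Relation.Nullary using (yes; no)
  open import Relation.Binary.PropositionalEquality using (subst; module ≡-Reasoning)

  +-self-injective : ∀ {a b} → a + a ≡ b + b → a ≡ b
  +-self-injective {a} {b} a+a≡b+b = *-cancelˡ-≡ a b 2 (begin
    2 * a ≡⟨ double≡+ a ⟩
    a + a ≡⟨ a+a≡b+b ⟩
    b + b ≡⟨ double≡+ b ⟨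
    2 * b ∎)
    where
    open ≡-Reasoning
    double≡+ : ∀ x → 2 * x ≡ x + x
    double≡+ = solve-∀

  even≢even+odd : ∀ {n} m → suc n ≡ 2 * m → ∀ a b → b + b ≢ a + a + n
  even≢even+odd {n} m n+1≡2m a b b+b≡a+a+n = even≢odd (a + m) b (begin
    2 * (a + m)       ≡⟨ distribute a m ⟩
    a + a + 2 * m     ≡⟨ cong (_+_ (a + a)) n+1≡2m ⟨
    a + a + suc n     ≡⟨ +-suc (a + a) n ⟩
    suc (a + a + n)   ≡⟨ cong suc b+b≡a+a+n ⟨
    suc (b + b)       ≡⟨ cong suc (double≡+ b) ⟩
    suc (2 * b)       ∎)
    where
    open ≡-Reasoning
    distribute : ∀ a m → 2 * (a + m) ≡ a + a + 2 * m
    distribute = solve-∀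
    double≡+ : ∀ x → x + x ≡ 2 * x
    double≡+ = solve-∀

  module Modulo (n : ℕ) where

    -- For v < 2n and c < n, "v ≡ c (mod n)" holds exactly in these two forms.
    infix 4 _≡ᵐ_
    _≡ᵐ_ : ℕ → ℕ → Set
    v ≡ᵐ c = v ≡ c ⊎ v ≡ c + n

    private
      <n⇒≢+n : ∀ {a b} → a < n → a ≢ b + n
      <n⇒≢+n {a} {b} a<n a≡b+n = <⇒≱ a<n (subst (n ≤_) (sym a≡b+n) (m≤n+m n b))

    ≡ᵐ-unique : ∀ {v c c′} → c < n → c′ < n → v ≡ᵐ c → v ≡ᵐ c′ → c ≡ c′
    ≡ᵐ-unique _   _    (inj₁ v≡c) (inj₁ v≡c′) = trans (sym v≡c) v≡c′
    ≡ᵐ-unique _   _    (inj₂ v≡c) (inj₂ v≡c′) = +-cancelʳ-≡ n _ _ (trans (sym v≡c) v≡c′)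
    ≡ᵐ-unique c<n _    (inj₁ v≡c) (inj₂ v≡c′) = ⊥-elim (<n⇒≢+n c<n (trans (sym v≡c) v≡c′))
    ≡ᵐ-unique _ c′<n   (inj₂ v≡c) (inj₁ v≡c′) = ⊥-elim (<n⇒≢+n c′<n (trans (sym v≡c′) v≡c))

    +-cancelˡ-≡ᵐ : ∀ i {a b c} → a < n → b < n → i + a ≡ᵐ c → i + b ≡ᵐ c → a ≡ b
    +-cancelˡ-≡ᵐ i _ _ (inj₁ e₁) (inj₁ e₂) = +-cancelˡ-≡ i _ _ (trans e₁ (sym e₂))
    +-cancelˡ-≡ᵐ i _ _ (inj₂ e₁) (inj₂ e₂) = +-cancelˡ-≡ i _ _ (trans e₁ (sym e₂))
    +-cancelˡ-≡ᵐ i {a} {b} {c} _ b<n (inj₁ e₁) (inj₂ e₂) =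
      ⊥-elim (<n⇒≢+n b<n (+-cancelˡ-≡ i _ _ (begin
        i + b       ≡⟨ e₂ ⟩
        c + n       ≡⟨ cong (_+ n) e₁ ⟨
        i + a + n   ≡⟨ +-assoc i a n ⟩
        i + (a + n) ∎)))
      where open ≡-Reasoning
    +-cancelˡ-≡ᵐ i a<n b<n (inj₂ e₁) (inj₁ e₂) = sym (+-cancelˡ-≡ᵐ i b<n a<n (inj₁ e₂) (inj₂ e₁))

    complement : ℕ → ℕ → ℕ
    complement c i with i ≤? c
    ... | yes _ = c ∸ i
    ... | no _  = c + n ∸ i

    complement<n : ∀ {c i} → c < n → i < n → complement c i < n
    complement<n {c} {i} c<n i<n with i ≤? c
    ... | yes _   = ≤-<-trans (m∸n≤m c i) c<n
    ... | no i≰c  = subst (c + n ∸ i <_) (m+n∸m≡n i n)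
                     (∸-monoˡ-< (+-monoˡ-< n (≰⇒> i≰c)) (≤-trans (<⇒≤ i<n) (m≤n+m n c)))

    +-complement : ∀ {c i} → i < n → i + complement c i ≡ᵐ c
    +-complement {c} {i} i<n with i ≤? c
    ... | yes i≤c = inj₁ (m+[n∸m]≡n i≤c)
    ... | no _    = inj₂ (m+[n∸m]≡n (≤-trans (<⇒≤ i<n) (m≤n+m n c)))

    double : ℕ → ℕ
    double h with h + h <? n
    ... | yes _ = h + h
    ... | no _  = h + h ∸ n

    double<n : ∀ {h} → h < n → double h < n
    double<n {h} h<n with h + h <? n
    ... | yes h+h<n = h+h<n
    ... | no h+h≮n  = subst (h + h ∸ n <_) (m+n∸m≡n n n)
                        (∸-monoˡ-< (+-mono-< h<n h<n) (≮⇒≥ h+h≮n))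

    +-double : ∀ h → h + h ≡ᵐ double h
    +-double h with h + h <? n
    ... | yes _     = inj₁ refl
    ... | no h+h≮n  = inj₂ (sym (m∸n+n≡m (≮⇒≥ h+h≮n)))

    halve-unique : ∀ m → suc n ≡ 2 * m → ∀ {a b c} → a + a ≡ᵐ c → b + b ≡ᵐ c → a ≡ b
    halve-unique _ _ (inj₁ e₁) (inj₁ e₂) = +-self-injective (trans e₁ (sym e₂))
    halve-unique _ _ (inj₂ e₁) (inj₂ e₂) = +-self-injective (trans e₁ (sym e₂))
    halve-unique m n+1≡2m {a} {b} (inj₁ e₁) (inj₂ e₂) =
      ⊥-elim (even≢even+odd m n+1≡2m a b (trans e₂ (cong (_+ n) (sym e₁))))
    halve-unique m n+1≡2m {a} {b} (inj₂ e₁) (inj₁ e₂) =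
      ⊥-elim (even≢even+odd m n+1≡2m b a (trans e₁ (cong (_+ n) (sym e₂))))

  module Tournament {n m : ℕ} (n+1≡2m : suc n ≡ 2 * m) where
    open Modulo n

    Mirrored : Fin n → Fin n → Fin n → Set
    Mirrored h i j = toℕ i + toℕ j ≡ᵐ double (toℕ h)

    mirror : Fin n → Fin n → Fin n
    mirror h i = fromℕ< (complement<n (double<n (toℕ<n h)) (toℕ<n i))

    mirrored-mirror : ∀ h i → Mirrored h i (mirror h i)
    mirrored-mirror h i rewrite toℕ-fromℕ< (complement<n (double<n (toℕ<n h)) (toℕ<n i)) =
      +-complement (toℕ<n i)

    mirrored-sym : ∀ {h i j} → Mirrored h i j → Mirrored h j i
    mirrored-sym {h} {i} {j} = subst (_≡ᵐ double (toℕ h)) (+-comm (toℕ i) (toℕ j))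

    mirrored-unique : ∀ {h i j j′} → Mirrored h i j → Mirrored h i j′ → j ≡ j′
    mirrored-unique {i = i} {j} {j′} p q =
      toℕ-injective (+-cancelˡ-≡ᵐ (toℕ i) (toℕ<n j) (toℕ<n j′) p q)

    mirrored-self : ∀ h → Mirrored h h h
    mirrored-self h = +-double (toℕ h)

    mirror-involutive : ∀ h i → mirror h (mirror h i) ≡ i
    mirror-involutive h i =
      mirrored-unique (mirrored-mirror h (mirror h i)) (mirrored-sym {h} {i} (mirrored-mirror h i))

    mirror-injectiveʳ : ∀ {h i j} → mirror h i ≡ mirror h j → i ≡ j
    mirror-injectiveʳ {h} {i} {j} mhi≡mhj =
      trans (sym (mirror-involutive h i)) (trans (cong (mirror h) mhi≡mhj) (mirror-involutive h j))

    mirror-self : ∀ h → mirror h h ≡ h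
    mirror-self h = mirrored-unique (mirrored-mirror h h) (mirrored-self h)

    mirror-fixed⇒≡ : ∀ {h i} → mirror h i ≡ i → i ≡ h
    mirror-fixed⇒≡ {h} {i} mhi≡i =
      toℕ-injective (halve-unique m n+1≡2m (subst (Mirrored h i) mhi≡i (mirrored-mirror h i))
                                           (mirrored-self h))

    mirror-injectiveˡ : ∀ {h h′ i} → mirror h i ≡ mirror h′ i → h ≡ h′
    mirror-injectiveˡ {h} {h′} {i} mhi≡mh′i = toℕ-injective (halve-unique m n+1≡2m
      (mirrored-self h)
      (subst (toℕ h′ + toℕ h′ ≡ᵐ_) (sym doubles-equal) (mirrored-self h′)))
      where
      doubles-equal : double (toℕ h) ≡ double (toℕ h′)
      doubles-equal = ≡ᵐ-unique (double<n (toℕ<n h)) (double<n (toℕ<n h′))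
        (mirrored-mirror h i) (subst (Mirrored h′ i) (sym mhi≡mh′i) (mirrored-mirror h′ i))

    -- Round h of the round-robin tournament on the vertices zero (the point at
    -- infinity) and suc i (i ∈ ℤ/n): zero plays h, h plays zero, and otherwise
    -- i plays 2h − i.
    opponent : Fin n → Fin (suc n) → Fin (suc n)
    opponent h zero    = suc h
    opponent h (suc i) with i ≟ h
    ... | yes _ = zero
    ... | no _  = suc (mirror h i)

    opponent-involutive : ∀ h v → opponent h (opponent h v) ≡ v
    opponent-involutive h zero with h ≟ h
    ... | yes _   = refl
    ... | no h≢h  = ⊥-elim (h≢h refl)
    opponent-involutive h (suc i) with i ≟ h
    ... | yes i≡h = cong suc (sym i≡h)
    ... | no i≢h with mirror h i ≟ h
    ...   | yes mhi≡h = ⊥-elim (i≢h (mirror-injectiveʳ (trans mhi≡h (sym (mirror-self h)))))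
    ...   | no _      = cong suc (mirror-involutive h i)

    opponent-fixed-point-free : ∀ h v → opponent h v ≢ v
    opponent-fixed-point-free h zero    ()
    opponent-fixed-point-free h (suc i) with i ≟ h
    ... | yes _  = λ ()
    ... | no i≢h = λ e → i≢h (mirror-fixed⇒≡ (suc-injective e))

    opponents-differ : ∀ {h h′} → h ≢ h′ → ∀ v → opponent h v ≢ opponent h′ v
    opponents-differ h≢h′ zero e = h≢h′ (suc-injective e)
    opponents-differ {h} {h′} h≢h′ (suc i) with i ≟ h | i ≟ h′
    ... | yes i≡h | yes i≡h′ = λ _ → h≢h′ (trans (sym i≡h) i≡h′)
    ... | yes _   | no _     = λ ()
    ... | no _    | yes _    = λ ()
    ... | no _    | no _     = λ e → h≢h′ (mirror-injectiveˡ {i = i} (suc-injective e))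

    round : Fin n → PerfectMatching (suc n)
    round h = record
      { partner                  = opponent h
      ; partner-involutive       = opponent-involutive h
      ; partner-fixed-point-free = opponent-fixed-point-free h
      }

  roundRobin : ∀ {n m} → suc n ≡ 2 * m → DisjointPerfectMatchings (suc n) n
  roundRobin {m = m} n+1≡2m = record { matching = round ; disjoint = opponents-differ }
    where open Tournament {m = m} n+1≡2m

open WeighingMatrices using (mutually-quasi-unbiased)
open RoundRobin using (roundRobin)
open import Data.Nat using (zero; suc; _∸_; _*_; NonZero)
open import Data.Fin using () renaming (zero to fzero)
open import Data.Product using (Σ; _,_)

theorem5p2 : (d : ℕ) → .{{_ : NonZero d}} → (m : ℕ) → d ≡ 2 * m →
    Σ (Fin (d ∸ 1) → Mat d) (λ W → MutuallyQU d 2 4 1 (d ∸ 1) W)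
theorem5p2 zero {{()}}
theorem5p2 (suc n) m n+1≡2m = _ , mutually-quasi-unbiased fzero (roundRobin {m = m} n+1≡2m)
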